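{- Let $G$ be a simple graph on $n$ vertices with $\delta(G)\ge n/2+1$. Then the order of the edge scramble $\mathcal{E}(G)$ is $n-\alpha(G)$.
   Context: $\delta(G)$ is the minimum valence, $\alpha(G)$ the independence number. The edge scramble $\mathcal{E}(G)$ is the scramble whose eggs are the sets $\{u,v\}$ for all edges $uv$ of $G$. For a scramble (finite collection of nonempty vertex sets, called eggs, each inducing a connected subgraph), its order is $\min(h,e)$ where $h$ is the minimum size of a vertex set meeting every egg and $e$ is the minimum of $|E(A,A^C)|$ (number of edges between $A$ and $A^C=V(G)\setminus A$) over all $A\subseteq V(G)$ such that some egg is contained in $A$ and some egg is contained in $A^C$ ($+\infty$ if there is no such $A$). -}

module Defs where

open import Data.Nat using (ℕ; _≤_; _⊓_; _+_; _*_)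
open import Data.Bool using (Bool; true; false; _∧_; not; if_then_else_)
open import Data.Fin using (Fin)
open import Data.List using (List; map; allFin)
open import Data.Nat.ListAction using (sum)
open import Data.Maybe using (Maybe; just; nothing)
open import Data.Product using (Σ; ∃; _×_)
open import Data.Sum using (_⊎_)
open import Relation.Nullary using (¬_)
open import Relation.Binary.PropositionalEquality using (_≡_)

record Graph (n : ℕ) : Set where
  field
    adj   : Fin n → Fin n → Bool
    sym   : ∀ u v → adj u v ≡ adj v u
    loopless : ∀ u → adj u u ≡ false
open Graph public

VSet : ℕ → Set
VSet n = Fin n → Bool

_∈ₛ_ : ∀ {n} → Fin n → VSet n → Set
v ∈ₛ A = A v ≡ true

count : ∀ {n} → (Fin n → Bool) → ℕ
count {n} f = sum (map (λ v → if f v then 1 else 0) (allFin n))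

size : ∀ {n} → VSet n → ℕ
size = count

complement : ∀ {n} → VSet n → VSet n
complement A v = not (A v)

deg : ∀ {n} → Graph n → Fin n → ℕ
deg G u = count (adj G u)

IsLeast : (ℕ → Set) → ℕ → Set
IsLeast P k = P k × (∀ m → P m → k ≤ m)

IsGreatest : (ℕ → Set) → ℕ → Set
IsGreatest P k = P k × (∀ m → P m → m ≤ k)

Independent : ∀ {n} → Graph n → VSet n → Set
Independent G S = ∀ u v → u ∈ₛ S → v ∈ₛ S → adj G u v ≡ false

IsIndependenceNumber : ∀ {n} → Graph n → ℕ → Set
IsIndependenceNumber G a = IsGreatest (λ m → Σ (VSet _) λ S → Independent G S × size S ≡ m) a

-- Edge scramble: eggs are {u,v} for edges uv.
-- An egg {u,v} is contained in A.
EggIn : ∀ {n} → Graph n → VSet n → Set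
EggIn G A = ∃ λ u → ∃ λ v → adj G u v ≡ true × u ∈ₛ A × v ∈ₛ A

Hits : ∀ {n} → Graph n → VSet n → Set
Hits G S = ∀ u v → adj G u v ≡ true → u ∈ₛ S ⊎ v ∈ₛ S

IsHittingNumber : ∀ {n} → Graph n → ℕ → Set
IsHittingNumber G h = IsLeast (λ m → Σ (VSet _) λ S → Hits G S × size S ≡ m) h

cutSize : ∀ {n} → Graph n → VSet n → ℕ
cutSize G A = sum (map (λ u → count (λ v → A u ∧ not (A v) ∧ adj G u v)) (allFin _))

Separating : ∀ {n} → Graph n → VSet n → Set
Separating G A = EggIn G A × EggIn G (complement A)

-- e: nothing encodes +∞ (no separating A)
IsEggCutNumber : ∀ {n} → Graph n → Maybe ℕ → Set
IsEggCutNumber G (just e) = IsLeast (λ m → Σ (VSet _) λ A → Separating G A × cutSize G A ≡ m) e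
IsEggCutNumber G nothing = ¬ (Σ (VSet _) λ A → Separating G A)

min∞ : ℕ → Maybe ℕ → ℕ
min∞ h (just e) = h ⊓ e
min∞ h nothing = h

IsEdgeScrambleOrder : ∀ {n} → Graph n → ℕ → Set
IsEdgeScrambleOrder G k =
  ∃ λ h → ∃ λ e → IsHittingNumber G h × IsEggCutNumber G e × k ≡ min∞ h e

-- The complement of an independent set meets every edge and conversely, so the
-- hitting number of the edge scramble is n − α(G). The egg-cut number is at
-- least n: of a separating pair A, Aᶜ take the side with k ≤ n/2 vertices,
-- writing n = 2k + d. It contains an edge, so k ≥ 2, and each of its vertices
-- has at most k − 1 neighbours inside it, hence at least n/2 + 2 − k = (d + 4)/2
-- across the cut; summing, |E(A, Aᶜ)| ≥ k(d + 4)/2 ≥ 2k + d = n. So the order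
-- min(h, e) is h = n − α(G).
module Submission where

open import Defs renaming (sym to adj-sym)
open import Data.Nat using (ℕ; zero; suc; _≤_; _<_; _≤?_; _+_; _*_; _∸_; z≤n; s≤s)
open import Data.Nat.Properties renaming (_≟_ to _≟ℕ_)
open import Data.Nat.Induction using (<-rec)
open import Data.Nat.ListAction using () renaming (sum to sumList)
open import Data.Nat.Tactic.RingSolver using (solve-∀)
open import Data.Bool using (Bool; true; false; _∧_; not; if_then_else_)
open import Data.Bool.Properties using (not-¬; _≟_)
open import Data.Fin using (Fin)
open import Data.Fin.Properties using (any?)
open import Data.Fin.Subset.Properties using (anySubset?)
open import Data.List using (tabulate)
open import Data.List.Properties using (map-tabulate)
open import Data.Vec using (lookup) renaming (tabulate to tabulateᵛ)
open import Data.Vec.Properties using (lookup∘tabulate)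
open import Data.Maybe using (just; nothing)
open import Data.Product using (Σ; ∃; _×_; _,_)
open import Data.Sum using (inj₁; inj₂)
open import Function using (_∘_; id)
open import Relation.Nullary using (Dec; yes; no; contradiction)
open import Relation.Nullary.Decidable using (map′; _×-dec_)
open import Relation.Binary.PropositionalEquality
open import Algebra.Properties.Semiring.Sum +-*-semiring
  using (sum; sum-syntax; sum-cong-≗; sum-replicate-zero; ∑-comm; ∑-distrib-+; *-distribˡ-sum; *-distribʳ-sum)

∧-trueˡ : ∀ {p q} → p ∧ q ≡ true → p ≡ true
∧-trueˡ {true} _ = refl

ind : Bool → ℕ
ind b = if b then 1 else 0

sumList-tabulate : ∀ {n} (f : Fin n → ℕ) → sumList (tabulate f) ≡ sum f
sumList-tabulate {zero} f = refl
sumList-tabulate {suc n} f = cong (f Fin.zero +_) (sumList-tabulate (f ∘ Fin.suc))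

∑-mono-≤ : ∀ {n} {f g : Fin n → ℕ} → (∀ i → f i ≤ g i) → sum f ≤ sum g
∑-mono-≤ {zero} f≤g = z≤n
∑-mono-≤ {suc n} f≤g = +-mono-≤ (f≤g Fin.zero) (∑-mono-≤ (f≤g ∘ Fin.suc))

∑-mono-< : ∀ {n} {f g : Fin n → ℕ} → (∀ i → f i ≤ g i) → ∀ j → f j < g j → sum f < sum g
∑-mono-< f≤g Fin.zero fj<gj = +-mono-<-≤ fj<gj (∑-mono-≤ (f≤g ∘ Fin.suc))
∑-mono-< f≤g (Fin.suc j) fj<gj = +-mono-≤-< (f≤g Fin.zero) (∑-mono-< (f≤g ∘ Fin.suc) j fj<gj)

∑-const-1 : ∀ n → ∑[ i < n ] 1 ≡ n
∑-const-1 zero = refl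
∑-const-1 (suc n) = cong suc (∑-const-1 n)

module _ {n : ℕ} where

  count≡∑ : (P : Fin n → Bool) → count P ≡ ∑[ v < n ] ind (P v)
  count≡∑ P = trans (cong sumList (map-tabulate id (ind ∘ P))) (sumList-tabulate (ind ∘ P))

  count-cong : {P Q : Fin n → Bool} → (∀ v → P v ≡ Q v) → count P ≡ count Q
  count-cong {P} {Q} P≗Q = trans (count≡∑ P) (trans (sum-cong-≗ (cong ind ∘ P≗Q)) (sym (count≡∑ Q)))

  count-false : count {n} (λ _ → false) ≡ 0
  count-false = trans (count≡∑ _) (sum-replicate-zero n)

  count-complement : (P : Fin n → Bool) → count P + count (not ∘ P) ≡ n
  count-complement P = begin
    count P + count (not ∘ P)                         ≡⟨ cong₂ _+_ (count≡∑ P) (count≡∑ (not ∘ P)) ⟩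
    ∑[ v < n ] ind (P v) + ∑[ v < n ] ind (not (P v)) ≡⟨ ∑-distrib-+ (ind ∘ P) (ind ∘ not ∘ P) ⟨
    ∑[ v < n ] (ind (P v) + ind (not (P v)))          ≡⟨ sum-cong-≗ (λ v → ind-excluded-middle (P v)) ⟩
    ∑[ v < n ] 1                                      ≡⟨ ∑-const-1 n ⟩
    n                                                 ∎
    where
    open ≡-Reasoning
    ind-excluded-middle : ∀ b → ind b + ind (not b) ≡ 1
    ind-excluded-middle true = refl
    ind-excluded-middle false = refl

  size-complement : (S : VSet n) → size (complement S) ≡ n ∸ size S
  size-complement S = begin
    size (complement S)                   ≡⟨ m+n∸m≡n (size S) (size (complement S)) ⟨
    size S + size (complement S) ∸ size S ≡⟨ cong (_∸ size S) (count-complement S) ⟩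
    n ∸ size S                            ∎
    where open ≡-Reasoning

  count-partition : (P Q : Fin n → Bool) → count Q ≡ count (λ v → P v ∧ Q v) + count (λ v → not (P v) ∧ Q v)
  count-partition P Q = begin
    count Q                                                       ≡⟨ count≡∑ Q ⟩
    ∑[ v < n ] ind (Q v)                                          ≡⟨ sum-cong-≗ (λ v → ind-split (P v) (Q v)) ⟩
    ∑[ v < n ] (ind (P v ∧ Q v) + ind (not (P v) ∧ Q v))          ≡⟨ ∑-distrib-+ (λ v → ind (P v ∧ Q v)) (λ v → ind (not (P v) ∧ Q v)) ⟩
    ∑[ v < n ] ind (P v ∧ Q v) + ∑[ v < n ] ind (not (P v) ∧ Q v) ≡⟨ cong₂ _+_ (count≡∑ _) (count≡∑ _) ⟨
    count (λ v → P v ∧ Q v) + count (λ v → not (P v) ∧ Q v)       ∎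
    where
    open ≡-Reasoning
    ind-split : ∀ p q → ind q ≡ ind (p ∧ q) + ind (not p ∧ q)
    ind-split true q = sym (+-identityʳ (ind q))
    ind-split false q = refl

  ind-mono : ∀ {p q} → (p ≡ true → q ≡ true) → ind p ≤ ind q
  ind-mono {false} p⇒q = z≤n
  ind-mono {true} p⇒q rewrite p⇒q refl = ≤-refl

  count-mono-< : {P Q : Fin n → Bool} → (∀ v → P v ≡ true → Q v ≡ true)
               → ∀ x → P x ≡ false → Q x ≡ true → count P < count Q
  count-mono-< {P} {Q} P⊆Q x Px Qx
    rewrite count≡∑ P | count≡∑ Q =
      ∑-mono-< (λ v → ind-mono (P⊆Q v)) x (subst₂ (λ p q → ind p < ind q) (sym Px) (sym Qx) ≤-refl)

  count-pos : {P : Fin n → Bool} → ∀ x → P x ≡ true → 0 < count P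
  count-pos {P} x Px = subst (_< count P) count-false (count-mono-< (λ _ ()) x refl Px)

  count-*-≤-∑ : (P : Fin n → Bool) (c : ℕ) (f : Fin n → ℕ)
              → (∀ v → P v ≡ true → c ≤ f v) → count P * c ≤ sum f
  count-*-≤-∑ P c f bound = begin
    count P * c                    ≡⟨ cong (_* c) (count≡∑ P) ⟩
    (∑[ v < n ] ind (P v)) * c      ≡⟨ *-distribʳ-sum c (ind ∘ P) ⟩
    ∑[ v < n ] (ind (P v) * c)      ≤⟨ ∑-mono-≤ (λ v → ind-* (P v) (bound v)) ⟩
    sum f                          ∎
    where
    open ≤-Reasoning
    ind-* : ∀ p {m} → (p ≡ true → c ≤ m) → ind p * c ≤ m
    ind-* true c≤m = ≤-trans (≤-reflexive (*-identityˡ c)) (c≤m refl)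
    ind-* false c≤m = z≤n

least-witness : {P : ℕ → Set} → (∀ m → Dec (P m)) → ∀ {m} → P m → ∃ (IsLeast P)
least-witness {P} P? {m} = <-rec (λ m → P m → ∃ (IsLeast P)) search m
  where
  search : ∀ m → (∀ {k} → k < m → P k → ∃ (IsLeast P)) → P m → ∃ (IsLeast P)
  search m smaller Pm with anyUpTo? P? m
  ... | yes (k , k<m , Pk) = smaller k<m Pk
  ... | no ∄k<m = m , Pm , λ k Pk → ≮⇒≥ (λ k<m → ∄k<m (k , k<m , Pk))

-- A VSet is a function, so the search runs over vectors and needs P to respect pointwise equality.
any-VSet? : ∀ {n} {P : VSet n → Set} → (∀ {A B} → (∀ v → A v ≡ B v) → P A → P B)
          → (∀ A → Dec (P A)) → Dec (∃ P)
any-VSet? {P = P} resp P? = map′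
  (λ (s , Ps) → lookup s , Ps)
  (λ (A , PA) → tabulateᵛ A , resp (λ v → sym (lookup∘tabulate A v)) PA)
  (anySubset? (P? ∘ lookup))

k*[d+4]≤2c⇒k+k+d≤c : ∀ {k d c} → 2 ≤ k → k * (d + 4) ≤ 2 * c → k + k + d ≤ c
k*[d+4]≤2c⇒k+k+d≤c {k@(suc (suc j))} {d} {c} (s≤s (s≤s _)) k[d+4]≤2c = *-cancelˡ-≤ 2 (begin
  2 * (k + k + d)           ≤⟨ m≤m+n (2 * (k + k + d)) (j * d) ⟩
  2 * (k + k + d) + j * d   ≡⟨ expand j d ⟩
  k * (d + 4)               ≤⟨ k[d+4]≤2c ⟩
  2 * c                     ∎)
  where
  open ≤-Reasoning
  expand : ∀ j d → 2 * (2 + j + (2 + j) + d) + j * d ≡ (2 + j) * (d + 4)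
  expand = solve-∀

module _ {n : ℕ} (G : Graph n) where

  cutRow : VSet n → Fin n → ℕ
  cutRow A u = count (λ v → A u ∧ not (A v) ∧ adj G u v)

  outDeg : VSet n → Fin n → ℕ
  outDeg A u = count (λ v → not (A v) ∧ adj G u v)

  cutSize≡∑ : ∀ A → cutSize G A ≡ ∑[ u < n ] cutRow A u
  cutSize≡∑ A = trans (cong sumList (map-tabulate id (cutRow A))) (sumList-tabulate (cutRow A))

  cutSize≡∑∑ : ∀ A → cutSize G A ≡ ∑[ u < n ] ∑[ v < n ] ind (A u ∧ not (A v) ∧ adj G u v)
  cutSize≡∑∑ A = trans (cutSize≡∑ A) (sum-cong-≗ (λ u → count≡∑ (λ v → A u ∧ not (A v) ∧ adj G u v)))

  cutSize-cong : ∀ {A B} → (∀ v → A v ≡ B v) → cutSize G A ≡ cutSize G B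
  cutSize-cong {A} {B} A≗B = begin
    cutSize G A              ≡⟨ cutSize≡∑ A ⟩
    ∑[ u < n ] cutRow A u    ≡⟨ sum-cong-≗ (λ u → count-cong (λ v → cong₂ (λ a b → a ∧ not b ∧ adj G u v) (A≗B u) (A≗B v))) ⟩
    ∑[ u < n ] cutRow B u    ≡⟨ cutSize≡∑ B ⟨
    cutSize G B              ∎
    where open ≡-Reasoning

  cutSize-complement : ∀ A → cutSize G A ≡ cutSize G (complement A)
  cutSize-complement A = begin
    cutSize G A                                                          ≡⟨ cutSize≡∑∑ A ⟩
    ∑[ u < n ] ∑[ v < n ] ind (A u ∧ not (A v) ∧ adj G u v)              ≡⟨ ∑-comm (λ u v → ind (A u ∧ not (A v) ∧ adj G u v)) ⟩
    ∑[ v < n ] ∑[ u < n ] ind (A u ∧ not (A v) ∧ adj G u v)              ≡⟨ sum-cong-≗ (λ v → sum-cong-≗ (λ u → cong ind (swap u v))) ⟩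
    ∑[ v < n ] ∑[ u < n ] ind (not (A v) ∧ not (not (A u)) ∧ adj G v u) ≡⟨ cutSize≡∑∑ (complement A) ⟨
    cutSize G (complement A)                                             ∎
    where
    open ≡-Reasoning
    swap : ∀ u v → A u ∧ not (A v) ∧ adj G u v ≡ not (A v) ∧ not (not (A u)) ∧ adj G v u
    swap u v rewrite adj-sym G u v with A u | A v
    ... | true  | true  = refl
    ... | true  | false = refl
    ... | false | true  = refl
    ... | false | false = refl

  size-*-≤-2*cutSize : ∀ A c → (∀ u → u ∈ₛ A → c ≤ 2 * outDeg A u) → size A * c ≤ 2 * cutSize G A
  size-*-≤-2*cutSize A c bound = begin
    size A * c                     ≤⟨ count-*-≤-∑ A c (λ u → 2 * cutRow A u) bound′ ⟩
    ∑[ u < n ] (2 * cutRow A u)     ≡⟨ *-distribˡ-sum 2 (cutRow A) ⟨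
    2 * ∑[ u < n ] cutRow A u       ≡⟨ cong (2 *_) (cutSize≡∑ A) ⟨
    2 * cutSize G A                ∎
    where
    open ≤-Reasoning
    bound′ : ∀ u → u ∈ₛ A → c ≤ 2 * cutRow A u
    bound′ u u∈A rewrite u∈A = bound u u∈A

  inDeg<size : ∀ A u → u ∈ₛ A → count (λ v → A v ∧ adj G u v) < size A
  inDeg<size A u u∈A = count-mono-< (λ _ → ∧-trueˡ) u no-loop u∈A
    where
    no-loop : A u ∧ adj G u u ≡ false
    no-loop rewrite loopless G u | u∈A = refl

  deg<size+outDeg : ∀ A u → u ∈ₛ A → deg G u < size A + outDeg A u
  deg<size+outDeg A u u∈A = begin-strict
    deg G u                                      ≡⟨ count-partition A (adj G u) ⟩
    count (λ v → A v ∧ adj G u v) + outDeg A u   <⟨ +-monoˡ-< (outDeg A u) (inDeg<size A u u∈A) ⟩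
    size A + outDeg A u                          ∎
    where open ≤-Reasoning

  egg⇒2≤size : ∀ {A} → EggIn G A → 2 ≤ size A
  egg⇒2≤size {A} (u , v , uv , u∈A , v∈A) =
    ≤-trans (s≤s (count-pos v v-inside)) (inDeg<size A u u∈A)
    where
    v-inside : A v ∧ adj G u v ≡ true
    v-inside rewrite v∈A = uv

  module _ (δ≥ : ∀ v → n + 2 ≤ 2 * deg G v) where

    n≤cutSize-of-small-side : ∀ A → EggIn G A → size A + size A ≤ n → n ≤ cutSize G A
    n≤cutSize-of-small-side A egg small =
      subst (_≤ cutSize G A) (m+[n∸m]≡n small)
        (k*[d+4]≤2c⇒k+k+d≤c (egg⇒2≤size egg) (size-*-≤-2*cutSize A (d + 4) per-vertex))
      where
      k d : ℕ
      k = size A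
      d = n ∸ (k + k)

      per-vertex : ∀ u → u ∈ₛ A → d + 4 ≤ 2 * outDeg A u
      per-vertex u u∈A = +-cancelˡ-≤ (k + k) (d + 4) (2 * o) (begin
        k + k + (d + 4)   ≡⟨ +-assoc (k + k) d 4 ⟨
        n′ + 4            ≡⟨ +-assoc n′ 2 2 ⟨
        n′ + 2 + 2        ≤⟨ +-monoˡ-≤ 2 (subst (λ m → m + 2 ≤ 2 * deg G u) (sym (m+[n∸m]≡n small)) (δ≥ u)) ⟩
        2 * deg G u + 2   ≡⟨ +-comm (2 * deg G u) 2 ⟩
        2 + 2 * deg G u   ≡⟨ *-suc 2 (deg G u) ⟨
        2 * suc (deg G u) ≤⟨ *-monoʳ-≤ 2 (deg<size+outDeg A u u∈A) ⟩
        2 * (k + o)       ≡⟨ *-distribˡ-+ 2 k o ⟩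
        2 * k + 2 * o     ≡⟨ cong (λ m → k + m + 2 * o) (+-identityʳ k) ⟩
        k + k + 2 * o     ∎)
        where
        open ≤-Reasoning
        o = outDeg A u
        n′ = k + k + d

    n≤cutSize : ∀ A → Separating G A → n ≤ cutSize G A
    n≤cutSize A (egg , egg′) with size A + size A ≤? n
    ... | yes small = n≤cutSize-of-small-side A egg small
    ... | no ¬small = begin
      n                         ≤⟨ n≤cutSize-of-small-side (complement A) egg′ complement-small ⟩
      cutSize G (complement A)  ≡⟨ cutSize-complement A ⟨
      cutSize G A               ∎
      where
      open ≤-Reasoning
      Aᶜ<A : size (complement A) < size A
      Aᶜ<A = +-cancelˡ-< (size A) (size (complement A)) (size A)
               (subst (_< size A + size A) (sym (count-complement A)) (≰⇒> ¬small))
      complement-small : size (complement A) + size (complement A) ≤ n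
      complement-small = begin
        size (complement A) + size (complement A) ≤⟨ +-monoˡ-≤ (size (complement A)) (<⇒≤ Aᶜ<A) ⟩
        size A + size (complement A)              ≡⟨ count-complement A ⟩
        n                                         ∎

  complement-hits : ∀ S → Independent G S → Hits G (complement S)
  complement-hits S indep u v uv with S u in Su | S v in Sv
  ... | false | _     = inj₁ refl
  ... | true  | false = inj₂ refl
  ... | true  | true  with () ← trans (sym uv) (indep u v Su Sv)

  complement-independent : ∀ S → Hits G S → Independent G (complement S)
  complement-independent S hits u v u∉S v∉S with adj G u v in uv
  ... | false = refl
  ... | true with hits u v uv
  ...   | inj₁ u∈S = contradiction (cong not u∈S) (not-¬ u∉S)
  ...   | inj₂ v∈S = contradiction (cong not v∈S) (not-¬ v∉S)

  hittingNumber : ∀ {a} → IsIndependenceNumber G a → IsHittingNumber G (n ∸ a)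
  hittingNumber {a} ((S , indep , refl) , maximal) =
    (complement S , complement-hits S indep , size-complement S) , minimal
    where
    minimal : ∀ m → (Σ (VSet n) λ T → Hits G T × size T ≡ m) → n ∸ a ≤ m
    minimal m (T , hits , refl) = begin
      n ∸ a                 ≤⟨ ∸-monoʳ-≤ n (maximal _ (complement T , complement-independent T hits , size-complement T)) ⟩
      n ∸ (n ∸ size T)      ≡⟨ m∸[m∸n]≡n (subst (size T ≤_) (count-complement T) (m≤m+n (size T) _)) ⟩
      size T                ∎
      where open ≤-Reasoning

  eggIn? : ∀ A → Dec (EggIn G A)
  eggIn? A = any? λ u → any? λ v → adj G u v ≟ true ×-dec A u ≟ true ×-dec A v ≟ true

  eggIn-cong : ∀ {A B} → (∀ v → A v ≡ B v) → EggIn G A → EggIn G B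
  eggIn-cong A≗B (u , v , uv , u∈A , v∈A) = u , v , uv , trans (sym (A≗B u)) u∈A , trans (sym (A≗B v)) v∈A

  separating-cong : ∀ {A B} → (∀ v → A v ≡ B v) → Separating G A → Separating G B
  separating-cong A≗B (egg , egg′) = eggIn-cong A≗B egg , eggIn-cong (cong not ∘ A≗B) egg′

  separating? : ∀ A → Dec (Separating G A)
  separating? A = eggIn? A ×-dec eggIn? (complement A)

  eggCutNumber : ∃ (IsEggCutNumber G)
  eggCutNumber with any-VSet? separating-cong separating?
  ... | no ∄A = nothing , ∄A
  ... | yes (A , sep) = let e , least = least-witness cut? (A , sep , refl) in just e , least
    where
    cut? : ∀ m → Dec (Σ (VSet n) λ A → Separating G A × cutSize G A ≡ m)
    cut? m = any-VSet? (λ A≗B (sep , cut≡m) → separating-cong A≗B sep , trans (sym (cutSize-cong A≗B)) cut≡m)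
                       (λ A → separating? A ×-dec cutSize G A ≟ℕ m)

  min∞-below-eggCut : ∀ {h e} → (∀ A → Separating G A → h ≤ cutSize G A) → IsEggCutNumber G e → min∞ h e ≡ h
  min∞-below-eggCut {e = nothing} _ _ = refl
  min∞-below-eggCut {e = just _} h≤cut ((A , sep , refl) , _) = m≤n⇒m⊓n≡m (h≤cut A sep)

lemma3p1 : (n : ℕ) (G : Graph n)
           → (∀ v → n + 2 ≤ 2 * deg G v)
           → ∀ a → IsIndependenceNumber G a
           → IsEdgeScrambleOrder G (n ∸ a)
lemma3p1 n G δ≥ a α =
  let e , isE = eggCutNumber G
      n∸a≤cut A sep = ≤-trans (m∸n≤m n a) (n≤cutSize G δ≥ A sep)
  in n ∸ a , e , hittingNumber G α , isE , sym (min∞-below-eggCut G n∸a≤cut isE)
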